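{- $1\mathrm{C}_{=}\subsetneqq 1\mathrm{P}$.
   Context: A one-way nondeterministic finite automaton (1nfa) is $M=(Q,\Sigma,\{\rhd,\lhd\},\delta,q_0,Q_{acc},Q_{rej})$: finite state set $Q$, input alphabet $\Sigma$, endmarkers $\rhd,\lhd\notin\Sigma$, disjoint sets $Q_{acc},Q_{rej}\subseteq Q$ ($Q_{halt}=Q_{acc}\cup Q_{rej}$), transition function $\delta:(Q-Q_{halt})\times(\Sigma\cup\{\rhd,\lhd\})\to\mathcal P(Q)$. On input $x$ it reads $\rhd x\lhd$ left to right, moving its head one cell right at every step (no $\lambda$-moves), halting on entering a halting state. A path is accepting (resp. rejecting) if it enters $Q_{acc}$ (resp. $Q_{rej}$), otherwise neither. $\#M(x)$, $\#\overline{M}(x)$ are the numbers of accepting and rejecting paths on $x$. A family $\{M_n\}_{n\in\mathbb N}$ has polynomial size if $|Q_n|\le p(n)$ for a fixed polynomial $p$. A family of promise problems over a fixed alphabet $\Sigma$ is $\mathcal L=\{(L_n^{(+)},L_n^{(-)})\}_{n\in\mathbb N}$ with $L_n^{(+)},L_n^{(-)}\subseteq\Sigma^*$ disjoint. A family of partial functions is $\{(f_n,D_n)\}_n$, $D_n\subseteq\Sigma^*$. $1\mathrm{Gap}$ is the class of such families for which a polynomial-size family of 1nfa's satisfies $f_n(x)=\#M_n(x)-\#\overline{M}_n(x)$ for all $n$, $x\in D_n$. $\mathcal L\in1\mathrm C_{=}$ iff some $\{(f_n,D_n)\}\in1\mathrm{Gap}$ has $L_n^{(+)}\cup L_n^{(-)}\subseteq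 D_n$, $f_n=0$ on $L_n^{(+)}$, $f_n\ne0$ on $L_n^{(-)}$ for all $n$; $\mathcal L\in1\mathrm P$ iff some $\{(f_n,D_n)\}\in1\mathrm{Gap}$ has $L_n^{(+)}\cup L_n^{(-)}\subseteq D_n$, $f_n>0$ on $L_n^{(+)}$, $f_n\le0$ on $L_n^{(-)}$ for all $n$. -}

module Defs where

open import Data.Nat using (ℕ; zero; suc; _+_; _*_; _≤_)
open import Data.Integer using (ℤ; +_; _-_)
open import Data.Fin using (Fin)
open import Data.Bool using (Bool; true; false; if_then_else_)
open import Data.List using (List; []; _∷_; _++_; map; allFin; [_])
open import Data.Nat.ListAction using (sum)
open import Data.Product using (Σ; _×_; ∃)
open import Data.Empty using (⊥)
open import Relation.Binary.PropositionalEquality using (_≡_; _≢_)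
open import Relation.Nullary using (¬_)

Word : ℕ → Set
Word k = List (Fin k)

data TapeSym (k : ℕ) : Set where
  ▷   : TapeSym k
  ◁   : TapeSym k
  sym : Fin k → TapeSym k

tape : ∀ {k} → Word k → List (TapeSym k)
tape x = ▷ ∷ (map sym x ++ [ ◁ ])

-- Subsets of Q are represented as characteristic functions Fin m → Bool.
-- δ is given on all states but is never consulted on halting states.

record NFA (k m : ℕ) : Set where
  field
    δ    : Fin m → TapeSym k → Fin m → Bool
    q₀   : Fin m
    Qacc : Fin m → Bool
    Qrej : Fin m → Bool
    disjoint : ∀ q → Qacc q ≡ true → Qrej q ≡ false

module _ {k m : ℕ} (M : NFA k m) where
  open NFA M

  -- number of computation paths from state q on remaining tape w
  -- that enter a state in the given halting set `target`
  -- (computation halts as soon as a halting state is entered;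
  --  a path that moves off ◁ without halting is neither accepting nor rejecting)
  countPaths : (Fin m → Bool) → Fin m → List (TapeSym k) → ℕ
  countPaths target q w with Qacc q | Qrej q
  ... | true  | _     = if target q then 1 else 0
  ... | false | true  = if target q then 1 else 0
  ... | false | false = go w
    where
    go : List (TapeSym k) → ℕ
    go []      = 0
    go (a ∷ w') = sum (map (λ q' → if δ q a q' then countPaths target q' w' else 0) (allFin m))

#acc : ∀ {k m} → NFA k m → Word k → ℕ
#acc M x = countPaths M (NFA.Qacc M) (NFA.q₀ M) (tape x)

#rej : ∀ {k m} → NFA k m → Word k → ℕ
#rej M x = countPaths M (NFA.Qrej M) (NFA.q₀ M) (tape x)

gap : ∀ {k m} → NFA k m → Word k → ℤ
gap M x = + #acc M x - + #rej M x

evalPoly : List ℕ → ℕ → ℕ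
evalPoly []       n = 0
evalPoly (c ∷ cs) n = c + n * evalPoly cs n

record NFAFamily (k : ℕ) : Set where
  field
    size    : ℕ → ℕ
    machine : (n : ℕ) → NFA k (size n)

PolySize : ∀ {k} → NFAFamily k → Set
PolySize F = Σ (List ℕ) λ p → ∀ n → NFAFamily.size F n ≤ evalPoly p n

record PartialFunFamily (k : ℕ) : Set₁ where
  field
    f : ℕ → Word k → ℤ
    D : ℕ → Word k → Set

record PromiseFamily (k : ℕ) : Set₁ where
  field
    Lplus  : ℕ → Word k → Set
    Lminus : ℕ → Word k → Set
    disjoint : ∀ n x → Lplus n x → Lminus n x → ⊥

In1Gap : ∀ {k} → PartialFunFamily k → Set
In1Gap {k} F = Σ (NFAFamily k) λ M → PolySize M ×
  (∀ n x → PartialFunFamily.D F n x →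
     PartialFunFamily.f F n x ≡ gap (NFAFamily.machine M n) x)

open Data.Integer using (_>_) renaming (_≤_ to _≤ℤ_)

In1Ceq : ∀ {k} → PromiseFamily k → Set₁
In1Ceq {k} L = Σ (PartialFunFamily k) λ F → In1Gap F ×
  (∀ n x → (Lplus n x → D F n x) × (Lminus n x → D F n x)) ×
  (∀ n x → Lplus n x → f F n x ≡ + 0) ×
  (∀ n x → Lminus n x → f F n x ≢ + 0)
  where open PromiseFamily L
        open PartialFunFamily

In1P : ∀ {k} → PromiseFamily k → Set₁
In1P {k} L = Σ (PartialFunFamily k) λ F → In1Gap F ×
  (∀ n x → (Lplus n x → D F n x) × (Lminus n x → D F n x)) ×
  (∀ n x → Lplus n x → f F n x > + 0) ×
  (∀ n x → Lminus n x → f F n x ≤ℤ + 0)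
  where open PromiseFamily L
        open PartialFunFamily

-- Inclusion: if the gap f of a polynomial-size family is zero on the positive and nonzero on the
-- negative instances, run two copies of the machine in lockstep, accepting when their verdicts differ
-- and rejecting when they agree. This product has gap −f², and one extra branch that accepts at once
-- turns it into 1 − f², which is positive exactly where f vanishes.
--
-- Separation: {aⁱbʲ : j < i} against {aⁱbʲ : i ≤ j} is in 1P through a 4-state machine with gap
-- i − j. For an arbitrary m-state machine, cutting every path at the border between the a's and the
-- b's writes its gap on aⁱbʲ as Σ_q P_i(q) Q_j(q) over the m states, so the (m+1)×(m+1) matrix of
-- gaps has rank at most m; a 1C= machine would make this matrix triangular with nonzero diagonal.

module Submission where

open import Defs hiding (sym)
open import Data.Nat using (ℕ)
open import Data.Product using (Σ; _×_; _,_)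
open import Relation.Nullary using (¬_)
open import Algebra.Bundles using (Semiring)

module FinSums {c ℓ} (R : Semiring c ℓ) where

  open import Data.Nat.Base as ℕ using (zero; suc)
  open import Data.Fin using (Fin; zero; suc; _↑ˡ_; _↑ʳ_; combine; remQuot)
  open import Data.Fin.Properties using (remQuot-combine)
  open import Function using (_∘_)
  import Relation.Binary.PropositionalEquality as ≡
  open Semiring R hiding (zero)
  open import Algebra.Properties.Semiring.Sum R using (sum-syntax; sum-cong-≗; sum-cong-≋; *-distribˡ-sum; *-distribʳ-sum)

  ∑-↑ : ∀ m {n} (f : Fin (m ℕ.+ n) → Carrier) →
        ∑[ i < m ℕ.+ n ] f i ≈ ∑[ i < m ] f (i ↑ˡ n) + ∑[ j < n ] f (m ↑ʳ j)
  ∑-↑ zero    f = sym (+-identityˡ _)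
  ∑-↑ (suc m) f = trans (+-congˡ (∑-↑ m (f ∘ suc))) (sym (+-assoc (f zero) _ _))

  ∑-combine : ∀ m {n} (f : Fin (m ℕ.* n) → Carrier) →
              ∑[ P < m ℕ.* n ] f P ≈ ∑[ i < m ] ∑[ j < n ] f (combine i j)
  ∑-combine zero    f = refl
  ∑-combine (suc m) {n} f = trans (∑-↑ n f) (+-congˡ (∑-combine m (f ∘ (n ↑ʳ_))))

  ∑-remQuot : ∀ m {n} (f : Fin m × Fin n → Carrier) →
              ∑[ P < m ℕ.* n ] f (remQuot n P) ≈ ∑[ i < m ] ∑[ j < n ] f (i , j)
  ∑-remQuot m f = trans (∑-combine m (f ∘ remQuot _))
                        (reflexive (sum-cong-≗ λ i → sum-cong-≗ λ j → ≡.cong f (remQuot-combine i j)))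

  ∑∑-* : ∀ {m n} (f : Fin m → Carrier) (g : Fin n → Carrier) →
         ∑[ i < m ] ∑[ j < n ] (f i * g j) ≈ ∑[ i < m ] f i * ∑[ j < n ] g j
  ∑∑-* f g = sym (trans (*-distribʳ-sum _ f) (sum-cong-≋ λ i → *-distribˡ-sum (f i) g))

module PathCounting where

  open import Data.Nat using (zero; suc; _+_; _*_)
  import Data.Nat.Properties as ℕ
  open import Data.Fin using (Fin; zero; suc; _≟_)
  open import Data.Bool using (Bool; true; false; if_then_else_; _∧_; _∨_)
  open import Data.List using (List; []; _∷_; _++_; map; allFin; tabulate)
  import Data.List.Properties as List
  import Data.Nat.ListAction as List
  open import Function using (_∘_)
  open import Relation.Binary.PropositionalEquality
  open import Relation.Nullary using (does)
  open import Algebra.Properties.Semiring.Sum ℕ.+-*-semiring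
    using (sum-syntax; sum-cong-≗; ∑-distrib-+; ∑-comm; *-distribˡ-sum; *-distribʳ-sum; sum-replicate-zero)

  ⟦_⟧ : Bool → ℕ
  ⟦ b ⟧ = if b then 1 else 0

  if-then-0≡⟦⟧* : ∀ b x → (if b then x else 0) ≡ ⟦ b ⟧ * x
  if-then-0≡⟦⟧* true  x = sym (ℕ.+-identityʳ x)
  if-then-0≡⟦⟧* false x = refl

  ⟦∧⟧ : ∀ a b → ⟦ a ∧ b ⟧ ≡ ⟦ a ⟧ * ⟦ b ⟧
  ⟦∧⟧ true  b = sym (ℕ.+-identityʳ ⟦ b ⟧)
  ⟦∧⟧ false b = refl

  ⟦∨⟧ : ∀ a b → (a ≡ true → b ≡ false) → ⟦ a ∨ b ⟧ ≡ ⟦ a ⟧ + ⟦ b ⟧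
  ⟦∨⟧ true  b a⇒¬b rewrite a⇒¬b refl = refl
  ⟦∨⟧ false b _ = refl

  listSum-tabulate : ∀ {n} (f : Fin n → ℕ) → List.sum (tabulate f) ≡ ∑[ i < n ] f i
  listSum-tabulate {zero}  f = refl
  listSum-tabulate {suc n} f = cong (f zero +_) (listSum-tabulate (f ∘ suc))

  listSum-allFin : ∀ {n} (f : Fin n → ℕ) → List.sum (map f (allFin n)) ≡ ∑[ i < n ] f i
  listSum-allFin f = trans (cong List.sum (List.map-tabulate (λ i → i) f)) (listSum-tabulate f)

  ∑-⟦≟⟧* : ∀ {n} (i : Fin n) (f : Fin n → ℕ) → ∑[ j < n ] (⟦ does (j ≟ i) ⟧ * f j) ≡ f i
  ∑-⟦≟⟧* {suc n} zero    f =
    trans (cong₂ _+_ (ℕ.+-identityʳ (f zero)) (sum-replicate-zero n)) (ℕ.+-identityʳ (f zero))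
  ∑-⟦≟⟧* {suc n} (suc i) f = ∑-⟦≟⟧* i (f ∘ suc)

  module _ {k m} (M : NFA k m) where
    open NFA M
    open ≡-Reasoning

    halts : Fin m → Bool
    halts q = Qacc q ∨ Qrej q

    countPaths-halts : ∀ T q w → halts q ≡ true → countPaths M T q w ≡ ⟦ T q ⟧
    countPaths-halts T q w h with Qacc q | Qrej q
    ... | true  | _    = refl
    ... | false | true = refl
    countPaths-halts T q w () | false | false

    countPaths-[] : ∀ T q → countPaths M T q [] ≡ ⟦ halts q ∧ T q ⟧
    countPaths-[] T q with Qacc q | Qrej q
    ... | true  | _     = refl
    ... | false | true  = refl
    ... | false | false = refl

    countPaths-runs : ∀ T q c w → halts q ≡ false →
      countPaths M T q (c ∷ w) ≡ ∑[ q' < m ] (⟦ δ q c q' ⟧ * countPaths M T q' w)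
    countPaths-runs T q c w h with Qacc q | Qrej q
    countPaths-runs T q c w () | true  | _
    countPaths-runs T q c w () | false | true
    ... | false | false =
      trans (listSum-allFin (λ q' → if δ q c q' then countPaths M T q' w else 0))
            (sum-cong-≗ λ q' → if-then-0≡⟦⟧* (δ q c q') _)

    -- Halted states idle, so that paths can be cut at any position (countPaths-step, countPaths-++).
    step : Fin m → TapeSym k → Fin m → Bool
    step q c q' = if halts q then does (q' ≟ q) else δ q c q'

    countPaths-step : ∀ T q c w →
      countPaths M T q (c ∷ w) ≡ ∑[ q' < m ] (⟦ step q c q' ⟧ * countPaths M T q' w)
    countPaths-step T q c w with halts q in h
    ... | true  = trans (countPaths-halts T q (c ∷ w) h)
                        (sym (trans (∑-⟦≟⟧* q _) (countPaths-halts T q w h)))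
    ... | false = countPaths-runs T q c w h

    countPaths-∨ : ∀ S T → (∀ q → S q ≡ true → T q ≡ false) → ∀ q w →
      countPaths M (λ q → S q ∨ T q) q w ≡ countPaths M S q w + countPaths M T q w
    countPaths-∨ S T disj q w with halts q in h
    countPaths-∨ S T disj q w | true = begin
      countPaths M (λ q → S q ∨ T q) q w  ≡⟨ countPaths-halts _ q w h ⟩
      ⟦ S q ∨ T q ⟧                       ≡⟨ ⟦∨⟧ (S q) (T q) (disj q) ⟩
      ⟦ S q ⟧ + ⟦ T q ⟧                   ≡⟨ sym (cong₂ _+_ (countPaths-halts S q w h) (countPaths-halts T q w h)) ⟩
      countPaths M S q w + countPaths M T q w ∎
    countPaths-∨ S T disj q [] | false
      rewrite countPaths-[] (λ q → S q ∨ T q) q | countPaths-[] S q | countPaths-[] T q | h = refl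
    countPaths-∨ S T disj q (c ∷ w) | false = begin
      countPaths M (λ q → S q ∨ T q) q (c ∷ w)
        ≡⟨ countPaths-runs _ q c w h ⟩
      ∑[ q' < m ] (⟦ δ q c q' ⟧ * countPaths M (λ q → S q ∨ T q) q' w)
        ≡⟨ sum-cong-≗ (λ q' → trans (cong (⟦ δ q c q' ⟧ *_) (countPaths-∨ S T disj q' w))
                                    (ℕ.*-distribˡ-+ ⟦ δ q c q' ⟧ _ _)) ⟩
      ∑[ q' < m ] (⟦ δ q c q' ⟧ * countPaths M S q' w + ⟦ δ q c q' ⟧ * countPaths M T q' w)
        ≡⟨ ∑-distrib-+ (λ q' → ⟦ δ q c q' ⟧ * countPaths M S q' w) (λ q' → ⟦ δ q c q' ⟧ * countPaths M T q' w) ⟩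
      ∑[ q' < m ] (⟦ δ q c q' ⟧ * countPaths M S q' w) + ∑[ q' < m ] (⟦ δ q c q' ⟧ * countPaths M T q' w)
        ≡⟨ sym (cong₂ _+_ (countPaths-runs S q c w h) (countPaths-runs T q c w h)) ⟩
      countPaths M S q (c ∷ w) + countPaths M T q (c ∷ w) ∎

    reachCount : Fin m → List (TapeSym k) → Fin m → ℕ
    reachCount q []      q″ = ⟦ does (q″ ≟ q) ⟧
    reachCount q (c ∷ u) q″ = ∑[ q' < m ] (⟦ step q c q' ⟧ * reachCount q' u q″)

    countPaths-++ : ∀ T q u s →
      countPaths M T q (u ++ s) ≡ ∑[ q″ < m ] (reachCount q u q″ * countPaths M T q″ s)
    countPaths-++ T q []      s = sym (∑-⟦≟⟧* q _)
    countPaths-++ T q (c ∷ u) s = begin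
      countPaths M T q (c ∷ u ++ s)
        ≡⟨ countPaths-step T q c (u ++ s) ⟩
      ∑[ q' < m ] (⟦ step q c q' ⟧ * countPaths M T q' (u ++ s))
        ≡⟨ sum-cong-≗ (λ q' → cong (⟦ step q c q' ⟧ *_) (countPaths-++ T q' u s)) ⟩
      ∑[ q' < m ] (⟦ step q c q' ⟧ * ∑[ q″ < m ] (reachCount q' u q″ * C q″))
        ≡⟨ sum-cong-≗ (λ q' → *-distribˡ-sum ⟦ step q c q' ⟧ (λ q″ → reachCount q' u q″ * C q″)) ⟩
      ∑[ q' < m ] ∑[ q″ < m ] (⟦ step q c q' ⟧ * (reachCount q' u q″ * C q″))
        ≡⟨ ∑-comm (λ q' q″ → ⟦ step q c q' ⟧ * (reachCount q' u q″ * C q″)) ⟩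
      ∑[ q″ < m ] ∑[ q' < m ] (⟦ step q c q' ⟧ * (reachCount q' u q″ * C q″))
        ≡⟨ sum-cong-≗ (λ q″ → trans (sum-cong-≗ λ q' → sym (ℕ.*-assoc ⟦ step q c q' ⟧ _ _))
                                    (sym (*-distribʳ-sum (C q″) (λ q' → ⟦ step q c q' ⟧ * reachCount q' u q″)))) ⟩
      ∑[ q″ < m ] (reachCount q (c ∷ u) q″ * C q″) ∎
      where
      C : Fin m → ℕ
      C q″ = countPaths M T q″ s

module Squaring where

  open PathCounting
  open import Data.Nat using (_+_; _*_)
  import Data.Nat.Properties as ℕ
  open import Data.Fin using (Fin; zero; suc; combine; remQuot)
  open import Data.Fin.Properties using (remQuot-combine)
  open import Data.Bool using (Bool; true; false; _∧_; _∨_)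
  open import Data.Bool.Properties using (∧-conicalˡ; ∧-conicalʳ; ∧-commutativeMonoid)
  open import Data.List using ([]; _∷_)
  open import Data.Product using (proj₁; proj₂)
  open import Relation.Binary.PropositionalEquality
  open import Algebra.Bundles using (CommutativeMonoid)
  open import Algebra.Properties.CommutativeSemigroup ℕ.*-commutativeSemigroup
    using () renaming (interchange to *-interchange)
  open import Algebra.Properties.CommutativeSemigroup (CommutativeMonoid.commutativeSemigroup ∧-commutativeMonoid)
    using () renaming (interchange to ∧-interchange)
  open import Algebra.Properties.Semiring.Sum ℕ.+-*-semiring using (sum-syntax; sum-cong-≗)
  open FinSums ℕ.+-*-semiring using (∑-remQuot; ∑∑-*)

  _⊠_ : ∀ {m n} → (Fin m → Bool) → (Fin n → Bool) → Fin (m * n) → Bool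
  _⊠_ {m} {n} S T P = S (proj₁ (remQuot {m} n P)) ∧ T (proj₂ (remQuot {m} n P))

  ⊠-disjointˡ : ∀ {m n} {S S' : Fin m → Bool} (T T' : Fin n → Bool) →
                (∀ p → S p ≡ true → S' p ≡ false) →
                ∀ P → (S ⊠ T) P ≡ true → (S' ⊠ T') P ≡ false
  ⊠-disjointˡ T T' disj P h rewrite disj _ (∧-conicalˡ _ _ h) = refl

  private
    disagree⇒¬agree : ∀ a r a' r' → (a ≡ true → r ≡ false) → (a' ≡ true → r' ≡ false) →
                     (a ∧ r') ∨ (r ∧ a') ≡ true → (a ∧ a') ∨ (r ∧ r') ≡ false
    disagree⇒¬agree true  true  _     _     a⇒¬r _     _ with () ← a⇒¬r refl
    disagree⇒¬agree _     _     true  true  _     a⇒¬r _ with () ← a⇒¬r refl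
    disagree⇒¬agree true  false true  false _     _     ()
    disagree⇒¬agree true  false false true  _     _     _  = refl
    disagree⇒¬agree true  false false false _     _     ()
    disagree⇒¬agree false true  true  false _     _     _  = refl
    disagree⇒¬agree false true  false true  _     _     ()
    disagree⇒¬agree false true  false false _     _     ()
    disagree⇒¬agree false false _     _     _     _     ()

    disagree∨agree : ∀ a r a' r' → ((a ∧ r') ∨ (r ∧ a')) ∨ ((a ∧ a') ∨ (r ∧ r')) ≡ (a ∨ r) ∧ (a' ∨ r')
    disagree∨agree true  true  true  true  = refl
    disagree∨agree true  true  true  false = refl
    disagree∨agree true  true  false true  = refl
    disagree∨agree true  true  false false = refl
    disagree∨agree true  false true  true  = refl
    disagree∨agree true  false true  false = refl
    disagree∨agree true  false false true  = refl
    disagree∨agree true  false false false = refl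
    disagree∨agree false true  true  true  = refl
    disagree∨agree false true  true  false = refl
    disagree∨agree false true  false true  = refl
    disagree∨agree false true  false false = refl
    disagree∨agree false false _     _     = refl

  -- The copies run in lockstep, a halted copy idling until the other one halts.
  _⊗_ : ∀ {k m n} → NFA k m → NFA k n → NFA k (m * n)
  _⊗_ {m = m} {n} M N = record
    { δ        = λ P c P' → step M (proj₁ (remQuot {m} n P)) c (proj₁ (remQuot {m} n P'))
                          ∧ step N (proj₂ (remQuot {m} n P)) c (proj₂ (remQuot {m} n P'))
    ; q₀       = combine M.q₀ N.q₀
    ; Qacc     = λ P → (M.Qacc ⊠ N.Qrej) P ∨ (M.Qrej ⊠ N.Qacc) P
    ; Qrej     = λ P → (M.Qacc ⊠ N.Qacc) P ∨ (M.Qrej ⊠ N.Qrej) P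
    ; disjoint = λ P → disagree⇒¬agree _ _ _ _ (M.disjoint _) (N.disjoint _)
    }
    where module M = NFA M
          module N = NFA N

  module _ {k m n} (M : NFA k m) (N : NFA k n) where
    open ≡-Reasoning

    fst : Fin (m * n) → Fin m
    fst P = proj₁ (remQuot {m} n P)

    snd : Fin (m * n) → Fin n
    snd P = proj₂ (remQuot {m} n P)

    halts-⊗ : ∀ P → halts (M ⊗ N) P ≡ halts M (fst P) ∧ halts N (snd P)
    halts-⊗ P = disagree∨agree (NFA.Qacc M (fst P)) (NFA.Qrej M (fst P)) (NFA.Qacc N (snd P)) (NFA.Qrej N (snd P))

    countPaths-⊠ : ∀ S T P w →
      countPaths (M ⊗ N) (S ⊠ T) P w ≡ countPaths M S (fst P) w * countPaths N T (snd P) w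
    countPaths-⊠ S T P [] = begin
      countPaths (M ⊗ N) (S ⊠ T) P []             ≡⟨ countPaths-[] (M ⊗ N) (S ⊠ T) P ⟩
      ⟦ halts (M ⊗ N) P ∧ (S ⊠ T) P ⟧            ≡⟨ cong (λ h → ⟦ h ∧ (S ⊠ T) P ⟧) (halts-⊗ P) ⟩
      ⟦ (halts M p ∧ halts N q) ∧ (S p ∧ T q) ⟧  ≡⟨ cong ⟦_⟧ (∧-interchange (halts M p) _ _ _) ⟩
      ⟦ (halts M p ∧ S p) ∧ (halts N q ∧ T q) ⟧  ≡⟨ ⟦∧⟧ (halts M p ∧ S p) _ ⟩
      ⟦ halts M p ∧ S p ⟧ * ⟦ halts N q ∧ T q ⟧  ≡⟨ sym (cong₂ _*_ (countPaths-[] M S p) (countPaths-[] N T q)) ⟩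
      countPaths M S p [] * countPaths N T q []   ∎
      where p = fst P
            q = snd P
    countPaths-⊠ S T P (c ∷ w) with halts (M ⊗ N) P in h
    ... | true = begin
      countPaths (M ⊗ N) (S ⊠ T) P (c ∷ w)  ≡⟨ countPaths-halts (M ⊗ N) (S ⊠ T) P (c ∷ w) h ⟩
      ⟦ S p ∧ T q ⟧                          ≡⟨ ⟦∧⟧ (S p) (T q) ⟩
      ⟦ S p ⟧ * ⟦ T q ⟧                      ≡⟨ sym (cong₂ _*_ (countPaths-halts M S p (c ∷ w) (∧-conicalˡ _ _ h′))
                                                                (countPaths-halts N T q (c ∷ w) (∧-conicalʳ _ _ h′))) ⟩
      countPaths M S p (c ∷ w) * countPaths N T q (c ∷ w) ∎
      where p = fst P
            q = snd P
            h′ = trans (sym (halts-⊗ P)) h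
    ... | false = begin
      countPaths (M ⊗ N) (S ⊠ T) P (c ∷ w)
        ≡⟨ countPaths-runs (M ⊗ N) (S ⊠ T) P c w h ⟩
      ∑[ P' < m * n ] (⟦ moves P' ⟧ * countPaths (M ⊗ N) (S ⊠ T) P' w)
        ≡⟨ sum-cong-≗ (λ P' → cong (⟦ moves P' ⟧ *_) (countPaths-⊠ S T P' w)) ⟩
      ∑[ P' < m * n ] g (remQuot n P')
        ≡⟨ ∑-remQuot m g ⟩
      ∑[ p' < m ] ∑[ q' < n ] g (p' , q')
        ≡⟨ sum-cong-≗ (λ p' → sum-cong-≗ λ q' → g≡A*B p' q') ⟩
      ∑[ p' < m ] ∑[ q' < n ] (A p' * B q')
        ≡⟨ ∑∑-* A B ⟩
      ∑[ p' < m ] A p' * ∑[ q' < n ] B q'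
        ≡⟨ sym (cong₂ _*_ (countPaths-step M S p c w) (countPaths-step N T q c w)) ⟩
      countPaths M S p (c ∷ w) * countPaths N T q (c ∷ w) ∎
      where
      p = fst P
      q = snd P
      moves : Fin (m * n) → Bool
      moves P' = step M p c (fst P') ∧ step N q c (snd P')
      g : Fin m × Fin n → ℕ
      g (p' , q') = ⟦ step M p c p' ∧ step N q c q' ⟧ * (countPaths M S p' w * countPaths N T q' w)
      A : Fin m → ℕ
      A p' = ⟦ step M p c p' ⟧ * countPaths M S p' w
      B : Fin n → ℕ
      B q' = ⟦ step N q c q' ⟧ * countPaths N T q' w
      g≡A*B : ∀ p' q' → g (p' , q') ≡ A p' * B q'
      g≡A*B p' q' = trans (cong (_* _) (⟦∧⟧ (step M p c p') (step N q c q')))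
                          (*-interchange ⟦ step M p c p' ⟧ _ (countPaths M S p' w) _)

    countPaths-⊠-q₀ : ∀ S T w →
      countPaths (M ⊗ N) (S ⊠ T) (NFA.q₀ (M ⊗ N)) w ≡ countPaths M S (NFA.q₀ M) w * countPaths N T (NFA.q₀ N) w
    countPaths-⊠-q₀ S T w =
      trans (countPaths-⊠ S T (NFA.q₀ (M ⊗ N)) w)
            (cong (λ (p , q) → countPaths M S p w * countPaths N T q w) (remQuot-combine (NFA.q₀ M) (NFA.q₀ N)))

    #acc-⊗ : ∀ x → #acc (M ⊗ N) x ≡ #acc M x * #rej N x + #rej M x * #acc N x
    #acc-⊗ x = trans (countPaths-∨ (M ⊗ N) _ _ (⊠-disjointˡ (NFA.Qrej N) (NFA.Qacc N) (NFA.disjoint M)) _ (tape x))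
                     (cong₂ _+_ (countPaths-⊠-q₀ (NFA.Qacc M) (NFA.Qrej N) (tape x))
                                (countPaths-⊠-q₀ (NFA.Qrej M) (NFA.Qacc N) (tape x)))

    #rej-⊗ : ∀ x → #rej (M ⊗ N) x ≡ #acc M x * #acc N x + #rej M x * #rej N x
    #rej-⊗ x = trans (countPaths-∨ (M ⊗ N) _ _ (⊠-disjointˡ (NFA.Qacc N) (NFA.Qrej N) (NFA.disjoint M)) _ (tape x))
                     (cong₂ _+_ (countPaths-⊠-q₀ (NFA.Qacc M) (NFA.Qacc N) (tape x))
                                (countPaths-⊠-q₀ (NFA.Qrej M) (NFA.Qrej N) (tape x)))

  -- State 0 is a fresh start state that branches into the accepting state 1 and into the first move
  -- of N, whose state q is simulated by suc (suc q).
  plusOne : ∀ {k n} → NFA k n → NFA k (2 + n)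
  plusOne {k} {n} N = record
    { δ = δ⁺ ; q₀ = zero ; Qacc = acc⁺ ; Qrej = rej⁺ ; disjoint = disjoint⁺ }
    where
    open NFA N
    δ⁺ : Fin (2 + n) → TapeSym k → Fin (2 + n) → Bool
    δ⁺ zero          c (suc zero)     = true
    δ⁺ zero          c (suc (suc q')) = step N q₀ c q'
    δ⁺ (suc (suc q)) c (suc (suc q')) = δ q c q'
    δ⁺ _             _ _              = false

    acc⁺ : Fin (2 + n) → Bool
    acc⁺ zero          = false
    acc⁺ (suc zero)    = true
    acc⁺ (suc (suc q)) = Qacc q

    rej⁺ : Fin (2 + n) → Bool
    rej⁺ (suc (suc q)) = Qrej q
    rej⁺ _             = false

    disjoint⁺ : ∀ q → acc⁺ q ≡ true → rej⁺ q ≡ false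
    disjoint⁺ (suc zero)    _ = refl
    disjoint⁺ (suc (suc q)) h = disjoint q h

  module _ {k n} (N : NFA k n) where
    open NFA N
    open ≡-Reasoning

    countPaths-plusOne : ∀ T q w →
      countPaths (plusOne N) T (suc (suc q)) w ≡ countPaths N (λ q → T (suc (suc q))) q w
    countPaths-plusOne T q [] = trans (countPaths-[] (plusOne N) T (suc (suc q))) (sym (countPaths-[] N _ q))
    countPaths-plusOne T q (c ∷ w) with halts N q in h
    ... | true  = trans (countPaths-halts (plusOne N) T (suc (suc q)) (c ∷ w) h) (sym (countPaths-halts N _ q _ h))
    ... | false = begin
      countPaths (plusOne N) T (suc (suc q)) (c ∷ w)
        ≡⟨ countPaths-runs (plusOne N) T (suc (suc q)) c w h ⟩
      ∑[ q' < n ] (⟦ δ q c q' ⟧ * countPaths (plusOne N) T (suc (suc q')) w)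
        ≡⟨ sum-cong-≗ (λ q' → cong (⟦ δ q c q' ⟧ *_) (countPaths-plusOne T q' w)) ⟩
      ∑[ q' < n ] (⟦ δ q c q' ⟧ * countPaths N (λ q → T (suc (suc q))) q' w)
        ≡⟨ sym (countPaths-runs N _ q c w h) ⟩
      countPaths N (λ q → T (suc (suc q))) q (c ∷ w) ∎

    countPaths-plusOne-q₀ : ∀ T c w →
      countPaths (plusOne N) T zero (c ∷ w) ≡ ⟦ T (suc zero) ⟧ + countPaths N (λ q → T (suc (suc q))) q₀ (c ∷ w)
    countPaths-plusOne-q₀ T c w = begin
      countPaths (plusOne N) T zero (c ∷ w)
        ≡⟨ countPaths-runs (plusOne N) T zero c w refl ⟩
      1 * ⟦ T (suc zero) ⟧ + ∑[ q' < n ] (⟦ step N q₀ c q' ⟧ * countPaths (plusOne N) T (suc (suc q')) w)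
        ≡⟨ cong₂ _+_ (ℕ.*-identityˡ ⟦ T (suc zero) ⟧)
                     (sum-cong-≗ λ q' → cong (⟦ step N q₀ c q' ⟧ *_) (countPaths-plusOne T q' w)) ⟩
      ⟦ T (suc zero) ⟧ + ∑[ q' < n ] (⟦ step N q₀ c q' ⟧ * countPaths N (λ q → T (suc (suc q))) q' w)
        ≡⟨ cong (⟦ T (suc zero) ⟧ +_) (sym (countPaths-step N _ q₀ c w)) ⟩
      ⟦ T (suc zero) ⟧ + countPaths N (λ q → T (suc (suc q))) q₀ (c ∷ w) ∎

    #acc-plusOne : ∀ x → #acc (plusOne N) x ≡ 1 + #acc N x
    #acc-plusOne x = countPaths-plusOne-q₀ (NFA.Qacc (plusOne N)) ▷ _

    #rej-plusOne : ∀ x → #rej (plusOne N) x ≡ #rej N x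
    #rej-plusOne x = countPaths-plusOne-q₀ (NFA.Qrej (plusOne N)) ▷ _

module Inclusion where

  open Squaring

  open import Data.Nat as ℕ using (zero; _+_; _*_; s≤s; z≤n)
  import Data.Nat.Properties as ℕ
  open import Data.Integer as ℤ using (+_; +[1+_]; -[1+_]; 1ℤ; 0ℤ; +≤+; +<+)
  import Data.Integer.Properties as ℤ
  open import Data.List using (List; []; _∷_; map)
  open import Data.Product using (proj₁; proj₂)
  open import Relation.Binary.PropositionalEquality
  open import Relation.Nullary using (contradiction)
  open import Data.Nat.Tactic.RingSolver using (solve-∀)
  open import Data.Integer.Tactic.RingSolver using () renaming (solve-∀ to ℤ-solve-∀)
  open ≡-Reasoning

  gap-⊗ : ∀ {k m n} (M : NFA k m) (N : NFA k n) x → gap (M ⊗ N) x ≡ ℤ.- (gap M x ℤ.* gap N x)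
  gap-⊗ M N x rewrite #acc-⊗ M N x | #rej-⊗ M N x = begin
    + (a * r′ + r * a′) ℤ.- + (a * a′ + r * r′)
      ≡⟨ cong₂ ℤ._-_ (+-bilinear a r′ r a′) (+-bilinear a a′ r r′) ⟩
    (+ a ℤ.* + r′ ℤ.+ + r ℤ.* + a′) ℤ.- (+ a ℤ.* + a′ ℤ.+ + r ℤ.* + r′)
      ≡⟨ ring (+ a) (+ r) (+ a′) (+ r′) ⟩
    ℤ.- ((+ a ℤ.- + r) ℤ.* (+ a′ ℤ.- + r′)) ∎
    where
    a = #acc M x
    r = #rej M x
    a′ = #acc N x
    r′ = #rej N x
    ring : ∀ a r a′ r′ →
           (a ℤ.* r′ ℤ.+ r ℤ.* a′) ℤ.- (a ℤ.* a′ ℤ.+ r ℤ.* r′) ≡ ℤ.- ((a ℤ.- r) ℤ.* (a′ ℤ.- r′))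
    ring = ℤ-solve-∀
    +-bilinear : ∀ a b c d → + (a * b + c * d) ≡ + a ℤ.* + b ℤ.+ + c ℤ.* + d
    +-bilinear a b c d = trans (ℤ.pos-+ (a * b) (c * d)) (cong₂ ℤ._+_ (ℤ.pos-* a b) (ℤ.pos-* c d))

  gap-plusOne : ∀ {k n} (N : NFA k n) x → gap (plusOne N) x ≡ 1ℤ ℤ.+ gap N x
  gap-plusOne N x rewrite #acc-plusOne N x | #rej-plusOne N x =
    trans (cong (ℤ._- + #rej N x) (ℤ.pos-+ 1 (#acc N x))) (ℤ.+-assoc 1ℤ (+ #acc N x) (ℤ.- + #rej N x))

  1-i*i≤0 : ∀ i → i ≢ 0ℤ → 1ℤ ℤ.- i ℤ.* i ℤ.≤ 0ℤ
  1-i*i≤0 i i≢0 = ℤ.i≤j⇒i-j≤0 (1≤i*i i i≢0)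
    where
    1≤i*i : ∀ i → i ≢ 0ℤ → 1ℤ ℤ.≤ i ℤ.* i
    1≤i*i (+ zero)  i≢0 = contradiction refl i≢0
    1≤i*i +[1+ n ]  _   = +≤+ (s≤s z≤n)
    1≤i*i -[1+ n ]  _   = +≤+ (s≤s z≤n)

  infixl 6 _+ᴾ_
  infixl 7 _*ᴾ_

  _+ᴾ_ : List ℕ → List ℕ → List ℕ
  []      +ᴾ q       = q
  (a ∷ p) +ᴾ []      = a ∷ p
  (a ∷ p) +ᴾ (b ∷ q) = a + b ∷ p +ᴾ q

  _*ᴾ_ : List ℕ → List ℕ → List ℕ
  []      *ᴾ q = []
  (a ∷ p) *ᴾ q = map (a *_) q +ᴾ (0 ∷ p *ᴾ q)

  evalPoly-+ : ∀ p q n → evalPoly (p +ᴾ q) n ≡ evalPoly p n + evalPoly q n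
  evalPoly-+ []      q       n = refl
  evalPoly-+ (a ∷ p) []      n = sym (ℕ.+-identityʳ _)
  evalPoly-+ (a ∷ p) (b ∷ q) n rewrite evalPoly-+ p q n = ring a b n (evalPoly p n) (evalPoly q n)
    where
    ring : ∀ a b n x y → a + b + n * (x + y) ≡ a + n * x + (b + n * y)
    ring = solve-∀

  evalPoly-scale : ∀ a q n → evalPoly (map (a *_) q) n ≡ a * evalPoly q n
  evalPoly-scale a []      n = sym (ℕ.*-zeroʳ a)
  evalPoly-scale a (b ∷ q) n rewrite evalPoly-scale a q n = ring a b n (evalPoly q n)
    where
    ring : ∀ a b n y → a * b + n * (a * y) ≡ a * (b + n * y)
    ring = solve-∀

  evalPoly-* : ∀ p q n → evalPoly (p *ᴾ q) n ≡ evalPoly p n * evalPoly q n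
  evalPoly-* []      q n = refl
  evalPoly-* (a ∷ p) q n
    rewrite evalPoly-+ (map (a *_) q) (0 ∷ p *ᴾ q) n | evalPoly-scale a q n | evalPoly-* p q n
    = ring a n (evalPoly p n) (evalPoly q n)
    where
    ring : ∀ a n x y → a * y + n * (x * y) ≡ (a + n * x) * y
    ring = solve-∀

  1C=⊆1P : ∀ {k} (L : PromiseFamily k) → In1Ceq L → In1P L
  1C=⊆1P {k} L (F , (M , (p , size≤p) , f≡gap) , inD , zero-on-L⁺ , nonzero-on-L⁻) =
    F′ , (M′ , ((2 ∷ []) +ᴾ p *ᴾ p , size′≤) , λ _ _ _ → refl) , inD , positive , nonpositive
    where
    open PromiseFamily L
    open PartialFunFamily F
    open NFAFamily M

    M′ : NFAFamily k
    M′ = record { size = λ n → 2 + size n * size n ; machine = λ n → plusOne (machine n ⊗ machine n) }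

    F′ : PartialFunFamily k
    F′ = record { f = λ n → gap (NFAFamily.machine M′ n) ; D = D }

    size′≤ : ∀ n → 2 + size n * size n ℕ.≤ evalPoly ((2 ∷ []) +ᴾ p *ᴾ p) n
    size′≤ n rewrite evalPoly-+ (2 ∷ []) (p *ᴾ p) n | evalPoly-* p p n | ℕ.*-zeroʳ n =
      ℕ.+-monoʳ-≤ 2 (ℕ.*-mono-≤ (size≤p n) (size≤p n))

    gap′ : ∀ n x → D n x → gap (NFAFamily.machine M′ n) x ≡ 1ℤ ℤ.- f n x ℤ.* f n x
    gap′ n x x∈D rewrite f≡gap n x x∈D =
      trans (gap-plusOne (machine n ⊗ machine n) x) (cong (λ g → 1ℤ ℤ.+ g) (gap-⊗ (machine n) (machine n) x))

    positive : ∀ n x → Lplus n x → gap (NFAFamily.machine M′ n) x ℤ.> 0ℤ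
    positive n x x∈L⁺ rewrite gap′ n x (proj₁ (inD n x) x∈L⁺) | zero-on-L⁺ n x x∈L⁺ = +<+ (s≤s z≤n)

    nonpositive : ∀ n x → Lminus n x → gap (NFAFamily.machine M′ n) x ℤ.≤ 0ℤ
    nonpositive n x x∈L⁻ rewrite gap′ n x (proj₂ (inD n x) x∈L⁻) = 1-i*i≤0 (f n x) (nonzero-on-L⁻ n x x∈L⁻)

module IntegerLinearAlgebra where

  open import Data.Nat as ℕ using (zero; suc; s≤s)
  import Data.Nat.Properties as ℕ
  open import Data.Integer using (ℤ; 0ℤ; 1ℤ; _+_; _*_; _-_; -_; _≟_)
  import Data.Integer.Properties as ℤ
  open import Data.Integer.Tactic.RingSolver using (solve-∀)
  open import Data.Fin as Fin using (Fin; zero; suc; toℕ; punchIn; inject; fromℕ<)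
  open import Data.Fin.Properties as Fin using (all?; ¬∀⟶∃¬; ¬∀⟶∃¬-smallest; punchIn-punchOut; punchInᵢ≢i)
  open import Data.Product using (∃)
  open import Data.Sum using ([_,_]′)
  open import Relation.Binary.PropositionalEquality
  open import Relation.Binary.Definitions using (tri<; tri≈; tri>)
  open import Relation.Nullary using (yes; no; contradiction)
  open import Algebra.Properties.Semiring.Sum ℤ.+-*-semiring
    using (sum-syntax; sum-cong-≗; ∑-distrib-+; ∑-comm; *-distribˡ-sum; *-distribʳ-sum; sum-remove; sum-replicate-zero)

  open ≡-Reasoning

  Nontrivial : ∀ {n} → (Fin n → ℤ) → Set
  Nontrivial c = ∃ λ i → c i ≢ 0ℤ

  LinearlyDependent : ∀ {n d} → (Fin n → Fin d → ℤ) → Set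
  LinearlyDependent {n} v = ∃ λ c → Nontrivial c × ∀ t → ∑[ i < n ] (c i * v i t) ≡ 0ℤ

  *-nonzero : ∀ {a b} → a ≢ 0ℤ → b ≢ 0ℤ → a * b ≢ 0ℤ
  *-nonzero {a} a≢0 b≢0 ab≡0 = [ a≢0 , b≢0 ]′ (ℤ.i*j≡0⇒i≡0∨j≡0 a ab≡0)

  firstZero⇒dependent : ∀ {n d} (v : Fin (suc n) → Fin d → ℤ) → (∀ t → v zero t ≡ 0ℤ) → LinearlyDependent v
  firstZero⇒dependent {n} v v₀≡0 = e₀ , (zero , λ ()) , λ t →
    cong₂ _+_ (trans (ℤ.*-identityˡ (v zero t)) (v₀≡0 t)) (sum-replicate-zero n)
    where
    e₀ : Fin (suc n) → ℤ
    e₀ zero    = 1ℤ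
    e₀ (suc _) = 0ℤ

  -- One step of Gaussian elimination with the pivot entry v zero t₀: clear coordinate t₀ from the
  -- remaining vectors, then drop it.
  eliminate : ∀ {n d} → (Fin (suc n) → Fin (suc d) → ℤ) → Fin (suc d) → Fin n → Fin d → ℤ
  eliminate v t₀ i t′ = v zero t₀ * v (suc i) (punchIn t₀ t′) - v (suc i) t₀ * v zero (punchIn t₀ t′)

  eliminate⇒dependent : ∀ {n d} (v : Fin (suc n) → Fin (suc d) → ℤ) t₀ → v zero t₀ ≢ 0ℤ →
                        LinearlyDependent (eliminate v t₀) → LinearlyDependent v
  eliminate⇒dependent {n} {d} v t₀ a≢0 (c′ , (k , c′ₖ≢0) , c′-kills) = c , (suc k , *-nonzero a≢0 c′ₖ≢0) , c-kills
    where
    a = v zero t₀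

    X : Fin (suc d) → ℤ
    X t = ∑[ i < n ] (c′ i * v (suc i) t)

    c : Fin (suc n) → ℤ
    c zero    = - X t₀
    c (suc i) = a * c′ i

    combination : ∀ t → ∑[ i < suc n ] (c i * v i t) ≡ a * X t - X t₀ * v zero t
    combination t = begin
      - X t₀ * v zero t + ∑[ i < n ] (a * c′ i * v (suc i) t)
        ≡⟨ cong (- X t₀ * v zero t +_) (trans (sum-cong-≗ λ i → ℤ.*-assoc a (c′ i) (v (suc i) t))
                                              (sym (*-distribˡ-sum a (λ i → c′ i * v (suc i) t)))) ⟩
      - X t₀ * v zero t + a * X t
        ≡⟨ ring (X t₀) (v zero t) a (X t) ⟩
      a * X t - X t₀ * v zero t ∎
      where
      ring : ∀ x y a z → - x * y + a * z ≡ a * z - x * y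
      ring = solve-∀

    eliminated : ∀ t′ → ∑[ i < n ] (c′ i * eliminate v t₀ i t′) ≡ a * X (punchIn t₀ t′) - X t₀ * v zero (punchIn t₀ t′)
    eliminated t′ = begin
      ∑[ i < n ] (c′ i * (a * v (suc i) t - v (suc i) t₀ * r))
        ≡⟨ sum-cong-≗ (λ i → ring (c′ i) a (v (suc i) t) (v (suc i) t₀) r) ⟩
      ∑[ i < n ] (a * (c′ i * v (suc i) t) + - r * (c′ i * v (suc i) t₀))
        ≡⟨ ∑-distrib-+ (λ i → a * (c′ i * v (suc i) t)) (λ i → - r * (c′ i * v (suc i) t₀)) ⟩
      ∑[ i < n ] (a * (c′ i * v (suc i) t)) + ∑[ i < n ] (- r * (c′ i * v (suc i) t₀))
        ≡⟨ sym (cong₂ _+_ (*-distribˡ-sum a (λ i → c′ i * v (suc i) t))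
                          (*-distribˡ-sum (- r) (λ i → c′ i * v (suc i) t₀))) ⟩
      a * X t + - r * X t₀
        ≡⟨ ring′ a (X t) r (X t₀) ⟩
      a * X t - X t₀ * r ∎
      where
      t = punchIn t₀ t′
      r = v zero t
      ring : ∀ x a p q r → x * (a * p - q * r) ≡ a * (x * p) + - r * (x * q)
      ring = solve-∀
      ring′ : ∀ a x r y → a * x + - r * y ≡ a * x - y * r
      ring′ = solve-∀

    c-kills : ∀ t → ∑[ i < suc n ] (c i * v i t) ≡ 0ℤ
    c-kills t with t₀ Fin.≟ t
    ... | yes refl = trans (combination t₀) (ring a (X t₀))
      where
      ring : ∀ a x → a * x - x * a ≡ 0ℤ
      ring = solve-∀
    ... | no t₀≢t = begin
      ∑[ i < suc n ] (c i * v i t)                  ≡⟨ combination t ⟩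
      a * X t - X t₀ * v zero t                    ≡⟨ cong (λ s → a * X s - X t₀ * v zero s) (sym (punchIn-punchOut t₀≢t)) ⟩
      a * X (punchIn t₀ t′) - X t₀ * v zero (punchIn t₀ t′) ≡⟨ sym (eliminated t′) ⟩
      ∑[ i < n ] (c′ i * eliminate v t₀ i t′)      ≡⟨ c′-kills t′ ⟩
      0ℤ ∎
      where t′ = Fin.punchOut t₀≢t

  linearlyDependent : ∀ {d n} → d ℕ.< n → (v : Fin n → Fin d → ℤ) → LinearlyDependent v
  linearlyDependent {zero}  (s≤s _)   v = firstZero⇒dependent v (λ ())
  linearlyDependent {suc d} (s≤s d<n) v with all? (λ t → v zero t ≟ 0ℤ)
  ... | yes v₀≡0 = firstZero⇒dependent v v₀≡0
  ... | no  v₀≢0 with ¬∀⟶∃¬ (suc d) _ (λ t → v zero t ≟ 0ℤ) v₀≢0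
  ...   | t₀ , a≢0 = eliminate⇒dependent v t₀ a≢0 (linearlyDependent d<n (eliminate v t₀))

  triangular-rows-independent : ∀ {n} (G : Fin n → Fin n → ℤ) →
    (∀ {i j} → j Fin.< i → G i j ≡ 0ℤ) → (∀ i → G i i ≢ 0ℤ) →
    ∀ c → Nontrivial c → ¬ (∀ j → ∑[ i < n ] (c i * G i j) ≡ 0ℤ)
  -- For the least K with c K ≢ 0, the combination of the rows has entry c K * G K K in column K.
  triangular-rows-independent {suc n} G below-diagonal diagonal c (k , cₖ≢0) c-kills
    with ¬∀⟶∃¬-smallest (suc n) _ (λ i → c i ≟ 0ℤ) (λ c≡0 → cₖ≢0 (c≡0 k))
  ... | K , cK≢0 , c≡0-before-K = *-nonzero cK≢0 (diagonal K) (begin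
    c K * G K K                                                    ≡⟨ sym (ℤ.+-identityʳ _) ⟩
    c K * G K K + 0ℤ                                               ≡⟨ cong (c K * G K K +_) (sym others-vanish) ⟩
    c K * G K K + ∑[ j < n ] (c (punchIn K j) * G (punchIn K j) K) ≡⟨ sym (sum-remove (λ i → c i * G i K)) ⟩
    ∑[ i < suc n ] (c i * G i K)                                   ≡⟨ c-kills K ⟩
    0ℤ ∎)
    where
    vanish : ∀ i → i ≢ K → c i * G i K ≡ 0ℤ
    vanish i i≢K with ℕ.<-cmp (toℕ i) (toℕ K)
    ... | tri< i<K _ _ = cong (_* G i K) (subst (λ j → c j ≡ 0ℤ) inject-fromℕ< (c≡0-before-K (fromℕ< i<K)))
      where
      inject-fromℕ< : inject (fromℕ< i<K) ≡ i
      inject-fromℕ< = Fin.toℕ-injective (trans (Fin.toℕ-inject (fromℕ< i<K)) (Fin.toℕ-fromℕ< i<K))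
    ... | tri≈ _ i≡K _ = contradiction (Fin.toℕ-injective i≡K) i≢K
    ... | tri> _ _ K<i = trans (cong (c i *_) (below-diagonal K<i)) (ℤ.*-zeroʳ (c i))

    others-vanish : ∑[ j < n ] (c (punchIn K j) * G (punchIn K j) K) ≡ 0ℤ
    others-vanish = trans (sum-cong-≗ λ j → vanish (punchIn K j) (punchInᵢ≢i K j)) (sum-replicate-zero n)

  triangular-factorisation⇒n≤d : ∀ {n d} (P Q : Fin n → Fin d → ℤ) →
    (∀ {i j} → j Fin.< i → ∑[ t < d ] (P i t * Q j t) ≡ 0ℤ) →
    (∀ i → ∑[ t < d ] (P i t * Q i t) ≢ 0ℤ) → n ℕ.≤ d
  triangular-factorisation⇒n≤d {n} {d} P Q below-diagonal diagonal = ℕ.≮⇒≥ λ d<n →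
    let (c , nontrivial , c-kills-P) = linearlyDependent d<n P
    in triangular-rows-independent G below-diagonal diagonal c nontrivial (λ j → begin
      ∑[ i < n ] (c i * G i j)
        ≡⟨ sum-cong-≗ (λ i → *-distribˡ-sum (c i) (λ t → P i t * Q j t)) ⟩
      ∑[ i < n ] ∑[ t < d ] (c i * (P i t * Q j t))
        ≡⟨ ∑-comm (λ i t → c i * (P i t * Q j t)) ⟩
      ∑[ t < d ] ∑[ i < n ] (c i * (P i t * Q j t))
        ≡⟨ sum-cong-≗ (λ t → trans (sum-cong-≗ λ i → sym (ℤ.*-assoc (c i) (P i t) (Q j t)))
                                   (sym (*-distribʳ-sum (Q j t) (λ i → c i * P i t)))) ⟩
      ∑[ t < d ] (∑[ i < n ] (c i * P i t) * Q j t)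
        ≡⟨ sum-cong-≗ (λ t → cong (_* Q j t) (c-kills-P t)) ⟩
      ∑[ t < d ] (0ℤ * Q j t)
        ≡⟨ sum-replicate-zero d ⟩
      0ℤ ∎)
    where
    G : Fin n → Fin n → ℤ
    G i j = ∑[ t < d ] (P i t * Q j t)

module Separation where

  open PathCounting
  open IntegerLinearAlgebra
  open import Defs using (sym)

  open import Data.Nat as ℕ using (zero; suc; _<_; _≤_)
  import Data.Nat.Properties as ℕ
  open import Data.Integer using (ℤ; +_; 0ℤ; +<+; +≤+; _+_; _-_; _*_; _>_) renaming (_≤_ to _≤ℤ_)
  import Data.Integer.Properties as ℤ
  open import Data.Integer.Tactic.RingSolver using (solve-∀)
  open import Data.Fin as Fin using (Fin; zero; suc; toℕ)
  open import Data.Fin.Patterns using (0F; 1F; 2F; 3F)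
  open import Data.Bool using (Bool; true; false)
  open import Data.List using (List; []; _∷_; _++_; map; replicate; [_])
  open import Data.List.Properties using (map-++; ++-assoc)
  open import Data.Product using (∃₂; proj₁; proj₂)
  open import Data.Unit using (⊤; tt)
  open import Function using (_∘_)
  open import Relation.Binary.PropositionalEquality hiding ([_]) renaming (sym to ≡-sym)
  import Algebra.Properties.Semiring.Sum ℕ.+-*-semiring as ℕΣ
  open import Algebra.Properties.Semiring.Sum ℤ.+-*-semiring
    using (sum-syntax; sum-cong-≗)

  open ≡-Reasoning

  +-∑ : ∀ {n} (f : Fin n → ℕ) → + ℕΣ.sum f ≡ ∑[ i < n ] (+ f i)
  +-∑ {zero}  f = refl
  +-∑ {suc n} f = trans (ℤ.pos-+ (f zero) _) (cong (λ s → + f zero + s) (+-∑ (f ∘ suc)))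

  ∑-distrib-sub : ∀ {n} (f g : Fin n → ℤ) → ∑[ i < n ] f i - ∑[ i < n ] g i ≡ ∑[ i < n ] (f i - g i)
  ∑-distrib-sub {zero}  f g = refl
  ∑-distrib-sub {suc n} f g =
    trans (ring (f zero) (g zero) _ _) (cong (λ s → f zero - g zero + s) (∑-distrib-sub (f ∘ suc) (g ∘ suc)))
    where
    ring : ∀ a b x y → (a + x) - (b + y) ≡ (a - b) + (x - y)
    ring = solve-∀

  module _ {k m} (M : NFA k m) where
    open NFA M

    gapFrom : Fin m → List (TapeSym k) → ℤ
    gapFrom q w = + countPaths M Qacc q w - + countPaths M Qrej q w

    gap-++ : ∀ x y →
      gap M (x ++ y) ≡ ∑[ q < m ] (+ reachCount M q₀ (▷ ∷ map sym x) q * gapFrom q (map sym y ++ [ ◁ ]))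
    gap-++ x y = begin
      + countPaths M Qacc q₀ (tape (x ++ y)) - + countPaths M Qrej q₀ (tape (x ++ y))
        ≡⟨ cong (λ w → + countPaths M Qacc q₀ w - + countPaths M Qrej q₀ w) tape-++ ⟩
      + countPaths M Qacc q₀ (u ++ s) - + countPaths M Qrej q₀ (u ++ s)
        ≡⟨ cong₂ _-_ (split Qacc) (split Qrej) ⟩
      ∑[ q < m ] (r q * + countPaths M Qacc q s) - ∑[ q < m ] (r q * + countPaths M Qrej q s)
        ≡⟨ ∑-distrib-sub (λ q → r q * + countPaths M Qacc q s) (λ q → r q * + countPaths M Qrej q s) ⟩
      ∑[ q < m ] (r q * + countPaths M Qacc q s - r q * + countPaths M Qrej q s)
        ≡⟨ sum-cong-≗ (λ q → factor (r q) _ _) ⟩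
      ∑[ q < m ] (r q * gapFrom q s) ∎
      where
      u = ▷ ∷ map sym x
      s = map sym y ++ [ ◁ ]
      r : Fin m → ℤ
      r q = + reachCount M q₀ u q
      tape-++ : tape (x ++ y) ≡ u ++ s
      tape-++ = cong (▷ ∷_) (trans (cong (_++ [ ◁ ]) (map-++ sym x y)) (++-assoc (map sym x) _ _))
      factor : ∀ r a b → r * a - r * b ≡ r * (a - b)
      factor = solve-∀
      split : ∀ T → + countPaths M T q₀ (u ++ s) ≡ ∑[ q < m ] (r q * + countPaths M T q s)
      split T = trans (cong +_ (countPaths-++ M T q₀ u s))
                      (trans (+-∑ (λ q → reachCount M q₀ u q ℕ.* countPaths M T q s))
                             (sum-cong-≗ λ q → ℤ.pos-* (reachCount M q₀ u q) _))

  𝑎 𝑏 : Fin 2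
  𝑎 = 0F
  𝑏 = 1F

  aⁱbʲ : ℕ → ℕ → Word 2
  aⁱbʲ i j = replicate i 𝑎 ++ replicate j 𝑏

  L⁺ L⁻ : Word 2 → Set
  L⁺ x = ∃₂ λ i j → x ≡ aⁱbʲ i j × j < i
  L⁻ x = ∃₂ λ i j → x ≡ aⁱbʲ i j × i ≤ j

  -- In the scanning state 1F every a spawns an accepting path and every b a rejecting one.
  counter : NFA 2 4
  counter = record { δ = δ ; q₀ = 0F ; Qacc = acc ; Qrej = rej ; disjoint = disjoint }
    where
    δ : Fin 4 → TapeSym 2 → Fin 4 → Bool
    δ 0F _        1F = true
    δ 1F (sym 0F) 1F = true
    δ 1F (sym 0F) 2F = true
    δ 1F (sym 1F) 1F = true
    δ 1F (sym 1F) 3F = true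
    δ _  _        _  = false

    acc rej : Fin 4 → Bool
    acc 2F = true
    acc _  = false
    rej 3F = true
    rej _  = false

    disjoint : ∀ q → acc q ≡ true → rej q ≡ false
    disjoint 2F _ = refl

  private
    scanned : ℕ → ℕ → List (TapeSym 2)
    scanned i j = map sym (aⁱbʲ i j) ++ [ ◁ ]

    #acc-scanning : ∀ i j → countPaths counter (NFA.Qacc counter) 1F (scanned i j) ≡ i
    #acc-scanning zero    zero    = refl
    #acc-scanning zero    (suc j) rewrite #acc-scanning zero j = refl
    #acc-scanning (suc i) j       rewrite #acc-scanning i j = ℕ.+-comm i 1

    #rej-scanning : ∀ i j → countPaths counter (NFA.Qrej counter) 1F (scanned i j) ≡ j
    #rej-scanning zero    zero    = refl
    #rej-scanning zero    (suc j) rewrite #rej-scanning zero j = ℕ.+-comm j 1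
    #rej-scanning (suc i) j       rewrite #rej-scanning i j = ℕ.+-identityʳ j

  gap-counter : ∀ i j → gap counter (aⁱbʲ i j) ≡ + i - + j
  gap-counter i j = cong₂ (λ a r → + a - + r) (trans (ℕ.+-identityʳ _) (#acc-scanning i j))
                                              (trans (ℕ.+-identityʳ _) (#rej-scanning i j))

  gap-counter-L⁺ : ∀ {x} → L⁺ x → gap counter x > 0ℤ
  gap-counter-L⁺ (i , j , refl , j<i)
    rewrite gap-counter i j | ℤ.m-n≡m⊖n i j | ℤ.⊖-≥ (ℕ.<⇒≤ j<i) = +<+ (ℕ.m<n⇒0<n∸m j<i)

  gap-counter-L⁻ : ∀ {x} → L⁻ x → gap counter x ≤ℤ 0ℤ
  gap-counter-L⁻ (i , j , refl , i≤j) rewrite gap-counter i j = ℤ.i≤j⇒i-j≤0 (+≤+ i≤j)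

  L : PromiseFamily 2
  L = record
    { Lplus    = λ _ → L⁺
    ; Lminus   = λ _ → L⁻
    ; disjoint = λ _ _ x∈L⁺ x∈L⁻ → ℤ.<⇒≱ (gap-counter-L⁺ x∈L⁺) (gap-counter-L⁻ x∈L⁻)
    }

  L∈1P : In1P L
  L∈1P = F , (counters , ((4 ∷ []) , λ n → ℕ.m≤m+n 4 (n ℕ.* 0)) , λ _ _ _ → refl)
           , (λ _ _ → (λ _ → tt) , (λ _ → tt)) , (λ _ _ → gap-counter-L⁺) , (λ _ _ → gap-counter-L⁻)
    where
    F : PartialFunFamily 2
    F = record { f = λ _ → gap counter ; D = λ _ _ → ⊤ }
    counters : NFAFamily 2
    counters = record { size = λ _ → 4 ; machine = λ _ → counter }

  L∉1C= : ¬ In1Ceq L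
  L∉1C= (F , (M , _ , f≡gap) , inD , zero-on-L⁺ , nonzero-on-L⁻) =
    ℕ.<-irrefl refl (triangular-factorisation⇒n≤d P Q below-diagonal diagonal)
    where
    open PartialFunFamily F
    -- L does not depend on the index, so the machine for index 0 already gives the contradiction.
    N = NFAFamily.machine M 0
    m = NFAFamily.size M 0

    P : Fin (suc m) → Fin m → ℤ
    P i q = + reachCount N (NFA.q₀ N) (▷ ∷ map sym (replicate (toℕ i) 𝑎)) q

    Q : Fin (suc m) → Fin m → ℤ
    Q j q = gapFrom N q (map sym (replicate (toℕ j) 𝑏) ++ [ ◁ ])

    f≡PQ : ∀ i j → D 0 (aⁱbʲ (toℕ i) (toℕ j)) → f 0 (aⁱbʲ (toℕ i) (toℕ j)) ≡ ∑[ q < m ] (P i q * Q j q)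
    f≡PQ i j x∈D = trans (f≡gap 0 _ x∈D) (gap-++ N _ _)

    below-diagonal : ∀ {i j} → j Fin.< i → ∑[ q < m ] (P i q * Q j q) ≡ 0ℤ
    below-diagonal {i} {j} j<i = trans (≡-sym (f≡PQ i j (proj₁ (inD 0 _) x∈L⁺))) (zero-on-L⁺ 0 _ x∈L⁺)
      where x∈L⁺ = toℕ i , toℕ j , refl , j<i

    diagonal : ∀ i → ∑[ q < m ] (P i q * Q i q) ≢ 0ℤ
    diagonal i PQ≡0 = nonzero-on-L⁻ 0 _ x∈L⁻ (trans (f≡PQ i i (proj₂ (inD 0 _) x∈L⁻)) PQ≡0)
      where x∈L⁻ = toℕ i , toℕ i , refl , ℕ.≤-refl

proposition4p9 : ((k : ℕ) (L : PromiseFamily k) → In1Ceq L → In1P L)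
    × Σ ℕ (λ k → Σ (PromiseFamily k) (λ L → In1P L × ¬ In1Ceq L))
proposition4p9 = (λ _ → Inclusion.1C=⊆1P) , 2 , Separation.L , Separation.L∈1P , Separation.L∉1C=
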